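{- For all integers $p\ge3$, $n\ge0$ and every edge $\{u,v\}$ of $H_p^n$: if $o(u)\le o(v)$ then $\deg(u)\le\deg(v)$.
   Context: For integers $p\ge 3$, $n\ge 0$, let $[p]_0=\{0,\dots,p-1\}$. The generalized Hanoi graph $H_p^n$ has vertex set $[p]_0^n$: a vertex $s=s_n\cdots s_1$ encodes a state of the Tower of Hanoi with $p$ pegs and $n$ discs of sizes $1<\dots<n$, disc $d$ lying on peg $s_d$. Two vertices are adjacent iff they have the form $\underline{s}\,i\,\overline{s}$ and $\underline{s}\,j\,\overline{s}$ with $i\ne j$, $\underline{s}\in[p]_0^{n-d}$, $\overline{s}\in([p]_0\setminus\{i,j\})^{d-1}$ for some $d$. The occupancy $o(s)$ is the number of pegs holding at least one disc in state $s$. -}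

module Defs where

open import Data.Nat using (ℕ; zero; suc; _≤_)
open import Data.Fin using (Fin; _<_)
open import Data.Fin.Properties using (any?; all?; _≟_; _<?_)
open import Data.Vec using (Vec; []; _∷_; lookup)
open import Data.List using (List; []; _∷_; length; filter; allFin; concatMap; map)
open import Data.Product using (Σ; ∃; _×_; _,_)
open import Relation.Nullary using (¬_; Dec; yes; no)
open import Relation.Nullary.Decidable using (_×-dec_; ¬?; _→-dec_)
open import Relation.Binary.PropositionalEquality using (_≡_)

-- A state of the Tower of Hanoi with p pegs and n discs: a vector of length n
-- whose entry at position d (d : Fin n) is the peg of disc (toℕ d + 1).
State : ℕ → ℕ → Set
State p n = Vec (Fin p) n

-- Adjacency in H_p^n:  s = s̲ i s̄, t = s̲ j s̄ with i ≠ j, where disc d is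
-- the moved disc, all larger discs agree (s̲), and all smaller discs agree
-- and lie on pegs different from i and j (s̄).
MoveAt : ∀ {p n} → State p n → State p n → Fin n → Set
MoveAt s t d =
  ¬ (lookup s d ≡ lookup t d) ×
  (∀ e → d < e → lookup s e ≡ lookup t e) ×
  (∀ e → e < d → (lookup s e ≡ lookup t e) ×
                  ¬ (lookup s e ≡ lookup s d) × ¬ (lookup s e ≡ lookup t d))

Adj : ∀ {p n} → State p n → State p n → Set
Adj {n = n} s t = Σ (Fin n) (MoveAt s t)

moveAt? : ∀ {p n} (s t : State p n) (d : Fin n) → Dec (MoveAt s t d)
moveAt? s t d =
  ¬? (lookup s d ≟ lookup t d) ×-dec
  all? (λ e → (d <? e) →-dec (lookup s e ≟ lookup t e)) ×-dec
  all? (λ e → (e <? d) →-dec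
     ((lookup s e ≟ lookup t e) ×-dec ¬? (lookup s e ≟ lookup s d)
        ×-dec ¬? (lookup s e ≟ lookup t d)))

adj? : ∀ {p n} (s t : State p n) → Dec (Adj s t)
adj? s t = any? (moveAt? s t)

allStates : ∀ p n → List (State p n)
allStates p zero = [] ∷ []
allStates p (suc n) = concatMap (λ i → map (i ∷_) (allStates p n)) (allFin p)

deg : ∀ {p n} → State p n → ℕ
deg {p} {n} s = length (filter (adj? s) (allStates p n))

Occupied : ∀ {p n} → State p n → Fin p → Set
Occupied {n = n} s i = ∃ λ (d : Fin n) → lookup s d ≡ i

occupied? : ∀ {p n} (s : State p n) (i : Fin p) → Dec (Occupied s i)
occupied? s i = any? (λ d → lookup s d ≟ i)

occ : ∀ {p n} → State p n → ℕ
occ {p} s = length (filter (occupied? s) (allFin p))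

-- The degree of a state depends only on its occupancy: ordering the occupied
-- pegs by the size of their top discs, the j-th smallest top disc can move to
-- exactly p − j pegs, so deg s = (p − 1) + ⋯ + (p − o(s)), which is monotone in
-- o(s). This is proved by peeling off the smallest disc: a neighbour either moves
-- it, or keeps it and makes a move of the larger discs that neither leaves nor
-- enters its peg. Carrying the list F of pegs blocked by smaller discs gives the
-- invariant: the number of neighbours avoiding F is moveCount c k, where c counts
-- the pegs outside F and k the occupied ones among them.

module Submission where

open import Defs
open import Data.Nat using (ℕ; zero; suc; _+_; _*_; _≤_; _∸_; z≤n; s≤s; s≤s⁻¹)
open import Data.Nat.Properties
  using (+-comm; +-identityʳ; *-zeroʳ; +-monoʳ-≤; +-*-semiring; module ≤-Reasoning)
open import Algebra.Properties.Semiring.Sum +-*-semiring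
  using (sum-syntax; sum-cong-≗; sum-replicate-zero; ∑-distrib-+; *-distribˡ-sum)
open import Data.Fin using (Fin; zero; suc; _<_)
open import Data.Fin.Properties using (_≟_; any?; suc-injective)
open import Data.Vec as Vec using (_∷_; []; lookup)
open import Data.Vec.Properties using (tabulate∘lookup; tabulate-cong)
open import Data.List using (List; []; _∷_; _++_; length; filter; allFin; concat; map; tabulate)
open import Data.List.Properties using (filter-++; length-++; filter-≐; filter-none; map-tabulate)
open import Data.List.Relation.Unary.All using (universal)
open import Data.List.Relation.Unary.Any using (here; there)
open import Data.List.Membership.Propositional using (_∉_)
open import Data.Product using (Σ; _×_; _,_; proj₁; proj₂)
open import Data.Empty using (⊥-elim)
open import Function using (_∘_; id)
open import Level using (0ℓ)
open import Relation.Nullary using (¬_; Dec; yes; no)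
open import Relation.Nullary.Decidable using (_×-dec_)
open import Relation.Unary using (Pred; Decidable)
open import Relation.Binary.PropositionalEquality
  using (_≡_; _≢_; refl; sym; trans; cong; cong₂; module ≡-Reasoning)

indicator : ∀ {A : Set} → Dec A → ℕ
indicator (yes _) = 1
indicator (no _)  = 0

indicator-cong : ∀ {A B : Set} → (A → B) → (B → A) → (A? : Dec A) (B? : Dec B) →
  indicator A? ≡ indicator B?
indicator-cong f g (yes a) (yes b) = refl
indicator-cong f g (yes a) (no ¬b) = ⊥-elim (¬b (f a))
indicator-cong f g (no ¬a) (yes b) = ⊥-elim (¬a (g b))
indicator-cong f g (no ¬a) (no ¬b) = refl

indicator-yes : ∀ {A : Set} → A → (A? : Dec A) → indicator A? ≡ 1
indicator-yes a (yes _)  = refl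
indicator-yes a (no ¬a) = ⊥-elim (¬a a)

indicator-no : ∀ {A : Set} → ¬ A → (A? : Dec A) → indicator A? ≡ 0
indicator-no ¬a (yes a) = ⊥-elim (¬a a)
indicator-no ¬a (no _)  = refl

sum-indicator-≟ : ∀ {p} (a : Fin p) (f : Fin p → ℕ) →
  ∑[ i < p ] (indicator (i ≟ a) * f i) ≡ f a
sum-indicator-≟ {suc p} zero f = begin
  f zero + 0 + ∑[ i < p ] (indicator (suc i ≟ zero) * f (suc i))
    ≡⟨ cong (f zero + 0 +_) (sum-cong-≗ (λ i → cong (_* f (suc i)) (indicator-no (λ ()) (suc i ≟ zero)))) ⟩
  f zero + 0 + ∑[ i < p ] 0
    ≡⟨ cong₂ _+_ (+-identityʳ (f zero)) (sum-replicate-zero p) ⟩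
  f zero + 0
    ≡⟨ +-identityʳ (f zero) ⟩
  f zero ∎
  where open ≡-Reasoning
sum-indicator-≟ {suc p} (suc a) f = begin
  indicator (zero ≟ suc a) * f zero + ∑[ i < p ] (indicator (suc i ≟ suc a) * f (suc i))
    ≡⟨ cong₂ _+_ (cong (_* f zero) (indicator-no (λ ()) (zero ≟ suc a)))
                 (sum-cong-≗ (λ i → cong (_* f (suc i)) (indicator-suc≟suc i))) ⟩
  ∑[ i < p ] (indicator (i ≟ a) * f (suc i))
    ≡⟨ sum-indicator-≟ a (f ∘ suc) ⟩
  f (suc a) ∎
  where
  open ≡-Reasoning
  indicator-suc≟suc : ∀ i → indicator (suc i ≟ suc a) ≡ indicator (i ≟ a)
  indicator-suc≟suc i = indicator-cong suc-injective (cong suc) (suc i ≟ suc a) (i ≟ a)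

sum-ones : ∀ n → ∑[ i < n ] 1 ≡ n
sum-ones zero    = refl
sum-ones (suc n) = cong suc (sum-ones n)

sum-split-at : ∀ {p} (a : Fin p) (f g : Fin p → ℕ) c →
  f a ≡ c + g a → (∀ i → i ≢ a → f i ≡ g i) → ∑[ i < p ] f i ≡ c + ∑[ i < p ] g i
sum-split-at {p} a f g c fa≡c+ga f≡g = begin
  ∑[ i < p ] f i                                        ≡⟨ sum-cong-≗ split ⟩
  ∑[ i < p ] (indicator (i ≟ a) * c + g i)              ≡⟨ ∑-distrib-+ (λ i → indicator (i ≟ a) * c) g ⟩
  ∑[ i < p ] (indicator (i ≟ a) * c) + ∑[ i < p ] g i   ≡⟨ cong (_+ ∑[ i < p ] g i) (sum-indicator-≟ a (λ _ → c)) ⟩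
  c + ∑[ i < p ] g i                                    ∎
  where
  open ≡-Reasoning
  split : ∀ i → f i ≡ indicator (i ≟ a) * c + g i
  split i with i ≟ a
  ... | yes refl = trans fa≡c+ga (cong (_+ g i) (sym (+-identityʳ c)))
  ... | no i≢a   = f≡g i i≢a

module _ {A : Set} {P : Pred A 0ℓ} (P? : Decidable P) where

  length-filter-map : ∀ {B : Set} (g : B → A) (xs : List B) →
    length (filter P? (map g xs)) ≡ length (filter (P? ∘ g) xs)
  length-filter-map g [] = refl
  length-filter-map g (x ∷ xs) with P? (g x)
  ... | yes _ = cong suc (length-filter-map g xs)
  ... | no _  = length-filter-map g xs

  length-filter-tabulate : ∀ {n} (f : Fin n → A) →
    length (filter P? (tabulate f)) ≡ ∑[ i < n ] indicator (P? (f i))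
  length-filter-tabulate {zero} f = refl
  length-filter-tabulate {suc n} f with P? (f zero)
  ... | yes _ = cong suc (length-filter-tabulate (f ∘ suc))
  ... | no _  = length-filter-tabulate (f ∘ suc)

  length-filter-concat-tabulate : ∀ {n} (G : Fin n → List A) →
    length (filter P? (concat (tabulate G))) ≡ ∑[ i < n ] length (filter P? (G i))
  length-filter-concat-tabulate {zero} G = refl
  length-filter-concat-tabulate {suc n} G = begin
    length (filter P? (G zero ++ concat (tabulate (G ∘ suc))))
      ≡⟨ cong length (filter-++ P? (G zero) _) ⟩
    length (filter P? (G zero) ++ filter P? (concat (tabulate (G ∘ suc))))
      ≡⟨ length-++ (filter P? (G zero)) ⟩
    length (filter P? (G zero)) + length (filter P? (concat (tabulate (G ∘ suc))))
      ≡⟨ cong (length (filter P? (G zero)) +_) (length-filter-concat-tabulate (G ∘ suc)) ⟩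
    ∑[ i < suc n ] length (filter P? (G i)) ∎
    where open ≡-Reasoning

∉-∷⁺ : ∀ {A : Set} {x y : A} {xs} → x ≢ y → x ∉ xs → x ∉ y ∷ xs
∉-∷⁺ x≢y x∉xs (here x≡y)   = x≢y x≡y
∉-∷⁺ x≢y x∉xs (there x∈xs) = x∉xs x∈xs

-- moveCount c k = (c ∸ 1) + (c ∸ 2) + ⋯ + (c ∸ k): when c pegs are available
-- and k of them are occupied, the j-th smallest top disc has c ∸ j targets.
moveCount : ℕ → ℕ → ℕ
moveCount c zero    = 0
moveCount c (suc k) = (c ∸ 1) + moveCount (c ∸ 1) k

moveCount-monoʳ-≤ : ∀ c {k m} → k ≤ m → moveCount c k ≤ moveCount c m
moveCount-monoʳ-≤ c {zero}          _         = z≤n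
moveCount-monoʳ-≤ c {suc k} {suc m} (s≤s k≤m) = +-monoʳ-≤ (c ∸ 1) (moveCount-monoʳ-≤ (c ∸ 1) k≤m)

moveCount-indicator : ∀ {A : Set} (A? : Dec A) c k →
  moveCount (indicator A? + c) (indicator A? + k) ≡ moveCount c k + indicator A? * c
moveCount-indicator (yes _) c k = trans (+-comm c (moveCount c k)) (cong (moveCount c k +_) (sym (+-identityʳ c)))
moveCount-indicator (no _)  c k = sym (+-identityʳ (moveCount c k))

module _ {p : ℕ} where

  countStates : ∀ n {P : Pred (State p n) 0ℓ} → Decidable P → ℕ
  countStates n P? = length (filter P? (allStates p n))

  countStates-∷ : ∀ n {P : Pred (State p (suc n)) 0ℓ} (P? : Decidable P) →
    countStates (suc n) P? ≡ ∑[ i < p ] countStates n (P? ∘ (i ∷_))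
  countStates-∷ n P? = begin
    length (filter P? (concat (map (λ i → map (i ∷_) (allStates p n)) (allFin p))))
      ≡⟨ cong (length ∘ filter P? ∘ concat) (map-tabulate id (λ i → map (i ∷_) (allStates p n))) ⟩
    length (filter P? (concat (tabulate (λ i → map (i ∷_) (allStates p n)))))
      ≡⟨ length-filter-concat-tabulate P? (λ i → map (i ∷_) (allStates p n)) ⟩
    ∑[ i < p ] length (filter P? (map (i ∷_) (allStates p n)))
      ≡⟨ sum-cong-≗ (λ i → length-filter-map P? (i ∷_) (allStates p n)) ⟩
    ∑[ i < p ] countStates n (P? ∘ (i ∷_)) ∎
    where open ≡-Reasoning

  countStates-none : ∀ n {P : Pred (State p n) 0ℓ} (P? : Decidable P) →
    (∀ t → ¬ P t) → countStates n P? ≡ 0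
  countStates-none n P? ¬P = cong length (filter-none P? (universal ¬P (allStates p n)))

  countStates-unique : ∀ n {P : Pred (State p n) 0ℓ} (P? : Decidable P) (s : State p n) →
    P s → (∀ t → P t → t ≡ s) → countStates n P? ≡ 1
  countStates-unique zero P? [] Ps _ with P? []
  ... | yes _  = refl
  ... | no ¬Ps = ⊥-elim (¬Ps Ps)
  countStates-unique (suc n) P? (a ∷ s) Ps unique = begin
    countStates (suc n) P?                        ≡⟨ countStates-∷ n P? ⟩
    ∑[ i < p ] countStates n (P? ∘ (i ∷_))        ≡⟨ sum-cong-≗ countWithHead ⟩
    ∑[ i < p ] (indicator (i ≟ a) * 1)            ≡⟨ sum-indicator-≟ a (λ _ → 1) ⟩
    1                                             ∎
    where
    open ≡-Reasoning
    countWithHead : ∀ i → countStates n (P? ∘ (i ∷_)) ≡ indicator (i ≟ a) * 1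
    countWithHead i with i ≟ a
    ... | yes refl = countStates-unique n (P? ∘ (i ∷_)) s Ps (λ t Pit → cong Vec.tail (unique (i ∷ t) Pit))
    ... | no i≢a   = countStates-none n (P? ∘ (i ∷_)) (λ t Pit → i≢a (cong Vec.head (unique (i ∷ t) Pit)))

  open import Data.List.Membership.DecPropositional (_≟_ {p}) using (_∉?_)

  MoveAvoiding : ∀ {n} → List (Fin p) → State p n → State p n → Fin n → Set
  MoveAvoiding F s t d = MoveAt s t d × lookup s d ∉ F × lookup t d ∉ F

  AdjAvoiding : ∀ {n} → List (Fin p) → State p n → State p n → Set
  AdjAvoiding {n} F s t = Σ (Fin n) (MoveAvoiding F s t)

  adjAvoiding? : ∀ {n} (F : List (Fin p)) (s t : State p n) → Dec (AdjAvoiding F s t)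
  adjAvoiding? F s t = any? λ d → moveAt? s t d ×-dec lookup s d ∉? F ×-dec lookup t d ∉? F

  ∷-adjAvoiding⁻ : ∀ {n} F a {s t : State p n} → AdjAvoiding F (a ∷ s) (a ∷ t) → AdjAvoiding (a ∷ F) s t
  ∷-adjAvoiding⁻ F a (zero , (a≢a , _) , _) = ⊥-elim (a≢a refl)
  ∷-adjAvoiding⁻ F a (suc d , (moved , above , below) , s∉F , t∉F) =
    d , (moved , (λ e d<e → above (suc e) (s≤s d<e)) , (λ e e<d → below (suc e) (s≤s e<d))) ,
    ∉-∷⁺ (λ a≡s → proj₁ (proj₂ (below zero (s≤s z≤n))) (sym a≡s)) s∉F ,
    ∉-∷⁺ (λ a≡t → proj₂ (proj₂ (below zero (s≤s z≤n))) (sym a≡t)) t∉F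

  ∷-adjAvoiding⁺ : ∀ {n} F a {s t : State p n} → AdjAvoiding (a ∷ F) s t → AdjAvoiding F (a ∷ s) (a ∷ t)
  ∷-adjAvoiding⁺ F a {s} {t} (d , (moved , above , below) , s∉aF , t∉aF) =
    suc d , (moved , above′ , below′) , s∉aF ∘ there , t∉aF ∘ there
    where
    above′ : ∀ e → suc d < e → lookup (a ∷ s) e ≡ lookup (a ∷ t) e
    above′ (suc e) d<e = above e (s≤s⁻¹ d<e)
    below′ : ∀ e → e < suc d → (lookup (a ∷ s) e ≡ lookup (a ∷ t) e) ×
               ¬ (lookup (a ∷ s) e ≡ lookup s d) × ¬ (lookup (a ∷ s) e ≡ lookup t d)
    below′ zero    _   = refl , s∉aF ∘ here ∘ sym , t∉aF ∘ here ∘ sym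
    below′ (suc e) e<d = below e (s≤s⁻¹ e<d)

  adjAvoiding-moveHead⁻ : ∀ {n} F {a i} {s t : State p n} → i ≢ a →
    AdjAvoiding F (a ∷ s) (i ∷ t) → t ≡ s × a ∉ F × i ∉ F
  adjAvoiding-moveHead⁻ F {s = s} {t} i≢a (zero , (_ , above , _) , a∉F , i∉F) =
    t≡s , a∉F , i∉F
    where
    t≡s : t ≡ s
    t≡s = begin
      t                        ≡⟨ sym (tabulate∘lookup t) ⟩
      Vec.tabulate (lookup t)  ≡⟨ tabulate-cong (λ e → sym (above (suc e) (s≤s z≤n))) ⟩
      Vec.tabulate (lookup s)  ≡⟨ tabulate∘lookup s ⟩
      s                        ∎
      where open ≡-Reasoning
  adjAvoiding-moveHead⁻ F i≢a (suc d , (_ , _ , below) , _) = ⊥-elim (i≢a (sym (proj₁ (below zero (s≤s z≤n)))))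

  adjAvoiding-moveHead⁺ : ∀ {n} F {a i} {s : State p n} → i ≢ a → a ∉ F → i ∉ F →
    AdjAvoiding F (a ∷ s) (i ∷ s)
  adjAvoiding-moveHead⁺ {n} F {a} {i} {s} i≢a a∉F i∉F =
    zero , ((λ a≡i → i≢a (sym a≡i)) , above , (λ _ ())) , a∉F , i∉F
    where
    above : ∀ e → zero {n} < e → lookup (a ∷ s) e ≡ lookup (i ∷ s) e
    above (suc e) _ = refl

  neighboursAvoiding : ∀ {n} → List (Fin p) → State p n → ℕ
  neighboursAvoiding {n} F s = countStates n (adjAvoiding? F s)

  freePegs : List (Fin p) → ℕ
  freePegs F = ∑[ i < p ] indicator (i ∉? F)

  occupiedFreePegs : ∀ {n} → List (Fin p) → State p n → ℕ
  occupiedFreePegs F s = ∑[ i < p ] indicator (i ∉? F ×-dec occupied? s i)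

  freePegs-∷ : ∀ F a → freePegs F ≡ indicator (a ∉? F) + freePegs (a ∷ F)
  freePegs-∷ F a = sum-split-at a _ _ _
    (sym (trans (cong (indicator (a ∉? F) +_) (indicator-no (λ a∉aF → a∉aF (here refl)) (a ∉? a ∷ F)))
                (+-identityʳ _)))
    (λ i i≢a → indicator-cong (∉-∷⁺ i≢a) (_∘ there) (i ∉? F) (i ∉? a ∷ F))

  occupiedFreePegs-∷ : ∀ {n} F a (s : State p n) →
    occupiedFreePegs F (a ∷ s) ≡ indicator (a ∉? F) + occupiedFreePegs (a ∷ F) s
  occupiedFreePegs-∷ F a s = sum-split-at a _ _ _
    (trans (indicator-cong proj₁ (_, (zero , refl)) (a ∉? F ×-dec occupied? (a ∷ s) a) (a ∉? F))
           (sym (trans (cong (indicator (a ∉? F) +_)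
             (indicator-no (λ (a∉aF , _) → a∉aF (here refl)) (a ∉? a ∷ F ×-dec occupied? s a)))
             (+-identityʳ _))))
    (λ i i≢a → indicator-cong (occupiedTail i≢a) (λ (i∉aF , d , sd≡i) → i∉aF ∘ there , suc d , sd≡i)
      (i ∉? F ×-dec occupied? (a ∷ s) i) (i ∉? a ∷ F ×-dec occupied? s i))
    where
    occupiedTail : ∀ {i} → i ≢ a → i ∉ F × Occupied (a ∷ s) i → i ∉ a ∷ F × Occupied s i
    occupiedTail i≢a (i∉F , zero , a≡i)    = ⊥-elim (i≢a (sym a≡i))
    occupiedTail i≢a (i∉F , suc d , sd≡i) = ∉-∷⁺ i≢a i∉F , d , sd≡i

  occupiedFreePegs-[] : ∀ F → occupiedFreePegs F [] ≡ 0
  occupiedFreePegs-[] F = trans (sum-cong-≗ (λ i → indicator-no (λ { (_ , () , _) }) (i ∉? F ×-dec occupied? [] i)))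
                                (sum-replicate-zero p)

  neighboursAvoiding-keepHead : ∀ {n} F a (s : State p n) →
    countStates n (adjAvoiding? F (a ∷ s) ∘ (a ∷_)) ≡ neighboursAvoiding (a ∷ F) s
  neighboursAvoiding-keepHead {n} F a s =
    cong length (filter-≐ _ _ (∷-adjAvoiding⁻ F a , ∷-adjAvoiding⁺ F a) (allStates p n))

  neighboursAvoiding-moveHead : ∀ {n} F {a i} (s : State p n) → i ≢ a →
    countStates n (adjAvoiding? F (a ∷ s) ∘ (i ∷_)) ≡ indicator (a ∉? F) * indicator (i ∉? a ∷ F)
  neighboursAvoiding-moveHead {n} F {a} {i} s i≢a with a ∉? F | i ∉? a ∷ F
  ... | yes a∉F | yes i∉aF = countStates-unique n _ s
          (adjAvoiding-moveHead⁺ F i≢a a∉F (i∉aF ∘ there))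
          (λ t adj → proj₁ (adjAvoiding-moveHead⁻ F i≢a adj))
  ... | yes a∉F | no ¬i∉aF = countStates-none n _
          (λ t adj → ¬i∉aF (∉-∷⁺ i≢a (proj₂ (proj₂ (adjAvoiding-moveHead⁻ F i≢a adj)))))
  ... | no ¬a∉F | _ = countStates-none n _
          (λ t adj → ¬a∉F (proj₁ (proj₂ (adjAvoiding-moveHead⁻ F i≢a adj))))

  neighboursAvoiding-∷ : ∀ {n} F a (s : State p n) →
    neighboursAvoiding F (a ∷ s) ≡ neighboursAvoiding (a ∷ F) s + indicator (a ∉? F) * freePegs (a ∷ F)
  neighboursAvoiding-∷ {n} F a s = begin
    neighboursAvoiding F (a ∷ s)
      ≡⟨ countStates-∷ n (adjAvoiding? F (a ∷ s)) ⟩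
    ∑[ i < p ] countStates n (adjAvoiding? F (a ∷ s) ∘ (i ∷_))
      ≡⟨ sum-split-at a _ _ _ keepHead (λ i → neighboursAvoiding-moveHead F s) ⟩
    neighboursAvoiding (a ∷ F) s + ∑[ i < p ] (indicator (a ∉? F) * indicator (i ∉? a ∷ F))
      ≡⟨ cong (neighboursAvoiding (a ∷ F) s +_) (sym (*-distribˡ-sum (indicator (a ∉? F)) (λ i → indicator (i ∉? a ∷ F)))) ⟩
    neighboursAvoiding (a ∷ F) s + indicator (a ∉? F) * freePegs (a ∷ F) ∎
    where
    open ≡-Reasoning
    keepHead : countStates n (adjAvoiding? F (a ∷ s) ∘ (a ∷_)) ≡
               neighboursAvoiding (a ∷ F) s + indicator (a ∉? F) * indicator (a ∉? a ∷ F)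
    keepHead = begin
      countStates n (adjAvoiding? F (a ∷ s) ∘ (a ∷_))
        ≡⟨ neighboursAvoiding-keepHead F a s ⟩
      neighboursAvoiding (a ∷ F) s
        ≡⟨ sym (+-identityʳ _) ⟩
      neighboursAvoiding (a ∷ F) s + 0
        ≡⟨ cong (neighboursAvoiding (a ∷ F) s +_) (sym (trans
             (cong (indicator (a ∉? F) *_) (indicator-no (λ a∉aF → a∉aF (here refl)) (a ∉? a ∷ F)))
             (*-zeroʳ (indicator (a ∉? F))))) ⟩
      neighboursAvoiding (a ∷ F) s + indicator (a ∉? F) * indicator (a ∉? a ∷ F) ∎

  neighboursAvoiding≡moveCount : ∀ {n} F (s : State p n) →
    neighboursAvoiding F s ≡ moveCount (freePegs F) (occupiedFreePegs F s)
  neighboursAvoiding≡moveCount F [] = begin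
    neighboursAvoiding F []                          ≡⟨ countStates-none 0 (adjAvoiding? F []) (λ { t (() , _) }) ⟩
    0                                                ≡⟨ cong (moveCount (freePegs F)) (sym (occupiedFreePegs-[] F)) ⟩
    moveCount (freePegs F) (occupiedFreePegs F [])   ∎
    where open ≡-Reasoning
  neighboursAvoiding≡moveCount F (a ∷ s) = begin
    neighboursAvoiding F (a ∷ s)
      ≡⟨ neighboursAvoiding-∷ F a s ⟩
    neighboursAvoiding (a ∷ F) s + indicator (a ∉? F) * freePegs (a ∷ F)
      ≡⟨ cong (_+ indicator (a ∉? F) * freePegs (a ∷ F)) (neighboursAvoiding≡moveCount (a ∷ F) s) ⟩
    moveCount (freePegs (a ∷ F)) (occupiedFreePegs (a ∷ F) s) + indicator (a ∉? F) * freePegs (a ∷ F)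
      ≡⟨ sym (moveCount-indicator (a ∉? F) _ _) ⟩
    moveCount (indicator (a ∉? F) + freePegs (a ∷ F)) (indicator (a ∉? F) + occupiedFreePegs (a ∷ F) s)
      ≡⟨ sym (cong₂ moveCount (freePegs-∷ F a) (occupiedFreePegs-∷ F a s)) ⟩
    moveCount (freePegs F) (occupiedFreePegs F (a ∷ s)) ∎
    where open ≡-Reasoning

  freePegs-[] : freePegs [] ≡ p
  freePegs-[] = trans (sum-cong-≗ (λ i → indicator-yes (λ ()) (i ∉? []))) (sum-ones p)

  deg≡neighboursAvoiding-[] : ∀ {n} (s : State p n) → deg s ≡ neighboursAvoiding [] s
  deg≡neighboursAvoiding-[] {n} s =
    cong length (filter-≐ (adj? s) (adjAvoiding? [] s)
      ((λ (d , move) → d , move , (λ ()) , (λ ())) , (λ (d , move , _) → d , move))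
      (allStates p n))

  occ≡occupiedFreePegs-[] : ∀ {n} (s : State p n) → occ s ≡ occupiedFreePegs [] s
  occ≡occupiedFreePegs-[] s = trans (length-filter-tabulate (occupied? s) id)
    (sum-cong-≗ (λ i → indicator-cong ((λ ()) ,_) proj₂ (occupied? s i) (i ∉? [] ×-dec occupied? s i)))

  deg≡moveCount-occ : ∀ {n} (s : State p n) → deg s ≡ moveCount p (occ s)
  deg≡moveCount-occ s = begin
    deg s                                             ≡⟨ deg≡neighboursAvoiding-[] s ⟩
    neighboursAvoiding [] s                           ≡⟨ neighboursAvoiding≡moveCount [] s ⟩
    moveCount (freePegs []) (occupiedFreePegs [] s)   ≡⟨ cong₂ moveCount freePegs-[] (sym (occ≡occupiedFreePegs-[] s)) ⟩
    moveCount p (occ s)                               ∎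
    where open ≡-Reasoning

-- The degree is a function of the occupancy alone.
mainTheorem16 : (p n : ℕ) → 3 ≤ p → (u v : State p n) → Adj u v →
    occ u ≤ occ v → deg u ≤ deg v
mainTheorem16 p n _ u v _ occu≤occv = begin
  deg u                ≡⟨ deg≡moveCount-occ u ⟩
  moveCount p (occ u)  ≤⟨ moveCount-monoʳ-≤ p occu≤occv ⟩
  moveCount p (occ v)  ≡⟨ deg≡moveCount-occ v ⟨
  deg v                ∎
  where open ≤-Reasoning
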